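{- Let $i_1 < i_2 < \cdots < i_k$ be prime numbers and let $m_{i_1}, \ldots, m_{i_k}$ be integers with $0 \leq m_{i_j} < i_j$ for all $j$. Then there exists $n \geq 0$ such that $\bar{b}_{i_j}(n) = m_{i_j}$ for all $j \in \{1, \ldots, k\}$.
   Context: Tchoukaillon boards. For each $n \geq 0$ define a sequence $b(n) = (b_1(n), b_2(n), \ldots)$ of nonnegative integers recursively: $b(0)$ is the all-zero sequence; given $b(n)$, let $p(n) = \min\{j \geq 1 : b_j(n) = 0\}$ and set $b_i(n+1) = b_i(n)$ if $i > p(n)$, $b_i(n+1) = i$ if $i = p(n)$, and $b_i(n+1) = b_i(n) - 1$ if $i < p(n)$. Reindexed boards: $\bar{b}_i(n) = b_{i-1}(n)$ for $i \geq 2$. -}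

module Defs where

open import Data.Nat using (ℕ; zero; suc)
open import Data.List using (List; []; _∷_)

-- A board b(n) is represented by the finite list [b_1(n), ..., b_L(n)];
-- all entries beyond the list are 0.

-- stepFrom i bs : one sowing step applied to the tail of the board starting at
-- position i (bs = [b_i, b_{i+1}, ...]).
stepFrom : ℕ → List ℕ → List ℕ
stepFrom i []             = i ∷ []
stepFrom i (zero ∷ xs)    = i ∷ xs
stepFrom i (suc x ∷ xs)   = x ∷ stepFrom (suc i) xs

board : ℕ → List ℕ
board zero    = []
board (suc n) = stepFrom 1 (board n)

-- entry at 0-based list index (default 0 outside the list)
entry : List ℕ → ℕ → ℕ
entry []       _       = 0
entry (x ∷ xs) zero    = x
entry (x ∷ xs) (suc j) = entry xs j

-- b i n = b_i(n) for i ≥ 1 (b 0 n is an unused dummy value 0)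
b : ℕ → ℕ → ℕ
b zero    n = 0
b (suc j) n = entry (board n) j

-- reindexed boards: bbar i n = b_{i-1}(n), meaningful for i ≥ 2
bbar : ℕ → ℕ → ℕ
bbar i n = b (i Data.Nat.∸ 1) n

module Submission where

open import Defs
open import Data.Nat using (ℕ; _<_)
open import Data.Fin using (Fin) renaming (_<_ to _<ᶠ_)
open import Data.Nat.Primality using (Prime)
open import Data.Product using (∃)
open import Relation.Binary.PropositionalEquality using (_≡_)

open import Data.Nat using (zero; suc; _+_; _*_; _∸_; _≤_; _!; z≤n; s≤s; s≤s⁻¹)
open import Data.Nat.Properties
  using (+-identityʳ; +-assoc; +-comm; +-suc; *-zeroʳ; *-assoc; *-comm; +-cancelʳ-≡;
         m+n≡0⇒m≡0; m+n≡0⇒n≡0; m≤n⇒∃[o]m+o≡n; m≤n⇒m<n∨m≡n; <⇒≤; ≤-refl; n<1+n)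
open import Data.Nat.Divisibility
  using (_∣_; _∤_; divides; ∣1⇒≡1; ∣m⇒∣m*n; >⇒∤; m≤n⇒m!∣n!)
open import Data.Nat.Primality using (¬prime[0]; ¬prime[1]; euclidsLemma; prime⇒irreducible)
open import Data.Nat.Coprimality using (Coprime; coprime-Bézout)
open import Data.Nat.GCD using (module Bézout)
open import Data.Nat.Tactic.RingSolver using (solve-∀)
open import Data.Fin using (toℕ; fromℕ<)
open import Data.Fin.Properties using (toℕ-injective; toℕ-fromℕ<; toℕ<n)
open import Data.List using (List; []; _∷_)
open import Data.Product using (_,_; _×_; proj₁; proj₂)
open import Data.Sum using (inj₁; inj₂)
open import Relation.Nullary using (contradiction)
open import Relation.Binary.PropositionalEquality
  using (refl; sym; trans; cong; cong₂; subst; module ≡-Reasoning)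

-- Position i of the board only sees the steps that reach it,
-- and on those it behaves like a single counter: its value runs through
-- 0, i, i-1, ..., 1, 0, i, ... (period i+1) and the step moves on to the
-- positions beyond i exactly when the value was nonzero, i.e. i times per
-- period.  Composing these counters, the number of the first n steps that
-- reach position a+1 grows by exactly a!·K when n grows by (a+1)!·K.  Hence
--   * b̄_q(n) is periodic in n with period q!  (position q-1 has period q), and
--   * for a prime p, adding multiples of (p-1)! to n shifts the argument of
--     the counter at position p-1 by multiples of (p-2)!, a unit mod p, so
--     b̄_p can be given any value below p (Bézout).
-- Adjusting the primes in increasing order, each adjustment is a multiple of
-- (p-1)!, which is a multiple of q! for every smaller q, so earlier entries
-- are kept.

-- sow i c: the part of the board from position i on, after c steps have
-- been sown into it.
sow : ℕ → ℕ → List ℕ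
sow i zero    = []
sow i (suc c) = stepFrom i (sow i c)

board≡sow : ∀ n → board n ≡ sow 1 n
board≡sow zero    = refl
board≡sow (suc n) = cong (stepFrom 1) (board≡sow n)

-- A step changes the entry h at position i to nextHead i h; it continues to
-- the later positions exactly when h ≠ 0, recorded by `passes h`.
nextHead : ℕ → ℕ → ℕ
nextHead i zero    = i
nextHead i (suc h) = h

passes : ℕ → ℕ
passes zero    = 0
passes (suc _) = 1

-- head i c: entry at position i after c steps; passed i c: how many of these
-- c steps went on to position i+1.
head : ℕ → ℕ → ℕ
head i zero    = 0
head i (suc c) = nextHead i (head i c)

passed : ℕ → ℕ → ℕ
passed i zero    = 0
passed i (suc c) = passes (head i c) + passed i c

sow-suc : ∀ i c → sow i (suc c) ≡ head i (suc c) ∷ sow (suc i) (passed i (suc c))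
sow-suc i zero = refl
sow-suc i (suc c) rewrite sow-suc i c with head i (suc c)
... | zero  = refl
... | suc _ = refl

entry-sow-head : ∀ i c → entry (sow i c) 0 ≡ head i c
entry-sow-head i zero    = refl
entry-sow-head i (suc c) rewrite sow-suc i c = refl

entry-sow-tail : ∀ i c j → entry (sow i c) (suc j) ≡ entry (sow (suc i) (passed i c)) j
entry-sow-tail i zero    j = refl
entry-sow-tail i (suc c) j rewrite sow-suc i c = refl

-- arrivals i j c: how many of c steps sown from position i reach position i+j.
arrivals : ℕ → ℕ → ℕ → ℕ
arrivals i zero    c = c
arrivals i (suc j) c = passed (i + j) (arrivals i j c)

arrivals-passed : ∀ i j c → arrivals (suc i) j (passed i c) ≡ arrivals i (suc j) c
arrivals-passed i zero    c rewrite +-identityʳ i = refl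
arrivals-passed i (suc j) c rewrite arrivals-passed i j c | +-suc i j = refl

entry-sow : ∀ j i c → entry (sow i c) j ≡ head (i + j) (arrivals i j c)
entry-sow zero    i c rewrite +-identityʳ i = entry-sow-head i c
entry-sow (suc j) i c = begin
  entry (sow i c) (suc j)                               ≡⟨ entry-sow-tail i c j ⟩
  entry (sow (suc i) (passed i c)) j                    ≡⟨ entry-sow j (suc i) (passed i c) ⟩
  head (suc i + j) (arrivals (suc i) j (passed i c))    ≡⟨ cong₂ head (sym (+-suc i j)) (arrivals-passed i j c) ⟩
  head (i + suc j) (arrivals i (suc j) c)               ∎
  where open ≡-Reasoning

entry-board : ∀ a n → entry (board n) a ≡ head (suc a) (arrivals 1 a n)
entry-board a n rewrite board≡sow n = entry-sow a 1 n

head-first-round : ∀ i r d → r + d ≡ i → head i (suc r) ≡ d × passed i (suc r) ≡ r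
head-first-round i zero    d eq = sym eq , refl
head-first-round i (suc r) d eq with head-first-round i r (suc d) (trans (+-suc r d) eq)
... | head≡ , passed≡ rewrite head≡ | passed≡ = refl , refl

head-period : ∀ i c → head i (c + suc i) ≡ head i c
head-period i zero    = proj₁ (head-first-round i i 0 (+-identityʳ i))
head-period i (suc c) = cong (nextHead i) (head-period i c)

passed-period : ∀ i c → passed i (c + suc i) ≡ passed i c + i
passed-period i zero    = proj₂ (head-first-round i i 0 (+-identityʳ i))
passed-period i (suc c) rewrite head-period i c | passed-period i c =
  sym (+-assoc (passes (head i c)) (passed i c) i)

add-multiple-suc : ∀ x P q → x + P * suc q ≡ (x + P * q) + P
add-multiple-suc = solve-∀

periodic-iterate : (f : ℕ → ℕ) (P D : ℕ) → (∀ c → f (c + P) ≡ f c + D)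
  → ∀ c q → f (c + P * q) ≡ f c + D * q
periodic-iterate f P D shift c zero
  rewrite *-zeroʳ P | *-zeroʳ D | +-identityʳ c | +-identityʳ (f c) = refl
periodic-iterate f P D shift c (suc q) = begin
  f (c + P * suc q)       ≡⟨ cong f (add-multiple-suc c P q) ⟩
  f ((c + P * q) + P)     ≡⟨ shift (c + P * q) ⟩
  f (c + P * q) + D       ≡⟨ cong (_+ D) (periodic-iterate f P D shift c q) ⟩
  (f c + D * q) + D       ≡⟨ sym (add-multiple-suc (f c) D q) ⟩
  f c + D * suc q         ∎
  where open ≡-Reasoning

head-periodic : ∀ i c q → head i (c + suc i * q) ≡ head i c
head-periodic i c q =
  trans (periodic-iterate (head i) (suc i) 0 (λ c → trans (head-period i c) (sym (+-identityʳ _))) c q)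
        (+-identityʳ (head i c))

passed-periodic : ∀ i c q → passed i (c + suc i * q) ≡ passed i c + i * q
passed-periodic i = periodic-iterate (passed i) (suc i) i (passed-period i)

head-residue : ∀ i c m → m ≤ i → suc i ∣ c + m → head i c ≡ m
head-residue i c m m≤i (divides zero c+m≡0)
  rewrite m+n≡0⇒m≡0 c c+m≡0 | m+n≡0⇒n≡0 c c+m≡0 = refl
head-residue i c m m≤i (divides (suc t) c+m≡) with m≤n⇒∃[o]m+o≡n m≤i
... | o , refl = begin
  head i c                   ≡⟨ cong (head i) c≡ ⟩
  head i (suc o + suc i * t) ≡⟨ head-periodic i (suc o) t ⟩
  head i (suc o)             ≡⟨ proj₁ (head-first-round i o m (+-comm o m)) ⟩
  m                          ∎
  where
  open ≡-Reasoning
  regroup : ∀ m o t → suc t * suc (m + o) ≡ (suc o + suc (m + o) * t) + m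
  regroup = solve-∀
  c≡ : c ≡ suc o + suc i * t
  c≡ = +-cancelʳ-≡ m c _ (trans c+m≡ (regroup m o t))

*-swap-front : ∀ x y z → x * (y * z) ≡ y * (x * z)
*-swap-front = solve-∀

arrivals-factorial : ∀ a n K → arrivals 1 a (n + suc a ! * K) ≡ arrivals 1 a n + a ! * K
arrivals-factorial zero    n K = refl
arrivals-factorial (suc a) n K = begin
  passed (suc a) (arrivals 1 a (n + (suc (suc a) * suc a !) * K))
    ≡⟨ cong (λ s → passed (suc a) (arrivals 1 a (n + s)))
            (trans (*-assoc (suc (suc a)) (suc a !) K) (*-swap-front (suc (suc a)) (suc a !) K)) ⟩
  passed (suc a) (arrivals 1 a (n + suc a ! * (suc (suc a) * K)))
    ≡⟨ cong (passed (suc a)) (arrivals-factorial a n (suc (suc a) * K)) ⟩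
  passed (suc a) (arrivals 1 a n + a ! * (suc (suc a) * K))
    ≡⟨ cong (λ s → passed (suc a) (arrivals 1 a n + s)) (*-swap-front (a !) (suc (suc a)) K) ⟩
  passed (suc a) (arrivals 1 a n + suc (suc a) * (a ! * K))
    ≡⟨ passed-periodic (suc a) (arrivals 1 a n) (a ! * K) ⟩
  passed (suc a) (arrivals 1 a n) + suc a * (a ! * K)
    ≡⟨ cong (passed (suc a) (arrivals 1 a n) +_) (sym (*-assoc (suc a) (a !) K)) ⟩
  passed (suc a) (arrivals 1 a n) + suc a ! * K
    ∎
  where open ≡-Reasoning

bbar-periodic : ∀ a n N → suc (suc a) ! ∣ N → bbar (suc (suc a)) (n + N) ≡ bbar (suc (suc a)) n
bbar-periodic a n _ (divides t refl) = begin
  entry (board (n + t * (suc (suc a) * suc a !))) a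
    ≡⟨ entry-board a _ ⟩
  head (suc a) (arrivals 1 a (n + t * (suc (suc a) * suc a !)))
    ≡⟨ cong (λ s → head (suc a) (arrivals 1 a (n + s))) (regroup t (suc (suc a)) (suc a !)) ⟩
  head (suc a) (arrivals 1 a (n + suc a ! * (suc (suc a) * t)))
    ≡⟨ cong (head (suc a)) (arrivals-factorial a n (suc (suc a) * t)) ⟩
  head (suc a) (arrivals 1 a n + a ! * (suc (suc a) * t))
    ≡⟨ cong (λ s → head (suc a) (arrivals 1 a n + s)) (*-swap-front (a !) (suc (suc a)) t) ⟩
  head (suc a) (arrivals 1 a n + suc (suc a) * (a ! * t))
    ≡⟨ head-periodic (suc a) (arrivals 1 a n) (a ! * t) ⟩
  head (suc a) (arrivals 1 a n)
    ≡⟨ sym (entry-board a n) ⟩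
  entry (board n) a
    ∎
  where
  open ≡-Reasoning
  regroup : ∀ t s f → t * (s * f) ≡ f * (s * t)
  regroup = solve-∀

bbar-stable : ∀ q p n K → 2 ≤ q → q < p → bbar q (n + (p ∸ 1) ! * K) ≡ bbar q n
bbar-stable (suc (suc a)) (suc p) n K _ (s≤s q≤p) =
  bbar-periodic a n _ (∣m⇒∣m*n K (m≤n⇒m!∣n! q≤p))
bbar-stable (suc zero) _ _ _ (s≤s ()) _

prime∤factorial : ∀ {p} → Prime p → ∀ j → j < p → p ∤ j !
prime∤factorial pr zero    _ p∣1 = ¬prime[1] (subst Prime (∣1⇒≡1 p∣1) pr)
prime∤factorial pr (suc j) j<p p∣ with euclidsLemma (suc j) (j !) pr p∣
... | inj₁ p∣1+j = >⇒∤ j<p p∣1+j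
... | inj₂ p∣j!  = prime∤factorial pr j (<⇒≤ j<p) p∣j!

prime∤⇒coprime : ∀ {p n} → Prime p → p ∤ n → Coprime p n
prime∤⇒coprime pr p∤n (d∣p , d∣n) with prime⇒irreducible pr d∣p
... | inj₁ d≡1 = d≡1
... | inj₂ refl = contradiction d∣n p∤n

negative-inverse : ∀ p′ u → Coprime (suc p′) u → ∃ λ w → suc p′ ∣ 1 + u * w
negative-inverse p′ u cop with coprime-Bézout cop
... | Bézout.+- x y eq = y , divides x (trans (cong (1 +_) (*-comm u y)) eq)
... | Bézout.-+ x y eq = y * p′ , divides (1 + x * p′) (begin
  1 + u * (y * p′)            ≡⟨ cong (1 +_) (*-swap-front u y p′) ⟩
  1 + y * (u * p′)            ≡⟨ cong (1 +_) (sym (*-assoc y u p′)) ⟩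
  1 + (y * u) * p′            ≡⟨ cong (λ s → 1 + s * p′) (sym eq) ⟩
  1 + (1 + x * suc p′) * p′   ≡⟨ expand x p′ ⟩
  (1 + x * p′) * suc p′       ∎)
  where
  open ≡-Reasoning
  expand : ∀ x p′ → 1 + (1 + x * suc p′) * p′ ≡ (1 + x * p′) * suc p′
  expand = solve-∀

solve-linear : ∀ p′ u A → Coprime (suc p′) u → ∃ λ K → suc p′ ∣ A + u * K
solve-linear p′ u A cop with negative-inverse p′ u cop
... | w , p∣1+uw = w * A , subst (suc p′ ∣_) (factor A u w) (∣m⇒∣m*n A p∣1+uw)
  where
  factor : ∀ A u w → (1 + u * w) * A ≡ A + u * (w * A)
  factor = solve-∀

bbar-adjustable : ∀ p n m → Prime p → m < p → ∃ λ K → bbar p (n + (p ∸ 1) ! * K) ≡ m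
bbar-adjustable zero          n m pr _ = contradiction pr ¬prime[0]
bbar-adjustable (suc zero)    n m pr _ = contradiction pr ¬prime[1]
bbar-adjustable (suc (suc a)) n m pr m<p = K , (begin
  entry (board (n + suc a ! * K)) a              ≡⟨ entry-board a _ ⟩
  head (suc a) (arrivals 1 a (n + suc a ! * K))  ≡⟨ cong (head (suc a)) (arrivals-factorial a n K) ⟩
  head (suc a) (arrivals 1 a n + a ! * K)        ≡⟨ head-residue (suc a) _ m (s≤s⁻¹ m<p) p∣shifted ⟩
  m                                              ∎)
  where
  open ≡-Reasoning
  a!-unit : Coprime (suc (suc a)) (a !)
  a!-unit = prime∤⇒coprime pr (prime∤factorial pr a (<⇒≤ (n<1+n (suc a))))
  solution : ∃ λ K → suc (suc a) ∣ (arrivals 1 a n + m) + a ! * K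
  solution = solve-linear (suc a) (a !) (arrivals 1 a n + m) a!-unit
  K : ℕ
  K = proj₁ solution
  swap : ∀ x m y → x + m + y ≡ x + y + m
  swap = solve-∀
  p∣shifted : suc (suc a) ∣ arrivals 1 a n + a ! * K + m
  p∣shifted = subst (suc (suc a) ∣_) (swap (arrivals 1 a n) m (a ! * K)) (proj₂ solution)

sequential-adjustment : ∀ {A : Set} k (f : Fin k → ℕ → A) (step : Fin k → ℕ) (target : Fin k → A)
  → (∀ j′ j → j′ <ᶠ j → ∀ n K → f j′ (n + step j * K) ≡ f j′ n)
  → (∀ j n → ∃ λ K → f j (n + step j * K) ≡ target j)
  → ∃ λ n → ∀ j → f j n ≡ target j
sequential-adjustment k f step target keeps adjust =
  let n , met = prefix k ≤-refl in n , λ j → met j (toℕ<n j)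
  where
  MeetsFirst : ℕ → ℕ → Set
  MeetsFirst l n = ∀ j → toℕ j < l → f j n ≡ target j

  extend : ∀ l (l<k : l < k) n → MeetsFirst l n → ∃ (MeetsFirst (suc l))
  extend l l<k n met = n + step new * K , extended
    where
    new : Fin k
    new = fromℕ< l<k
    K : ℕ
    K = proj₁ (adjust new n)
    extended : MeetsFirst (suc l) (n + step new * K)
    extended j j<1+l with m≤n⇒m<n∨m≡n (s≤s⁻¹ j<1+l)
    ... | inj₁ j<l = trans (keeps j new (subst (toℕ j <_) (sym (toℕ-fromℕ< l<k)) j<l) n K) (met j j<l)
    ... | inj₂ j≡l rewrite toℕ-injective {i = j} {j = new} (trans j≡l (sym (toℕ-fromℕ< l<k))) =
      proj₂ (adjust new n)

  prefix : ∀ l → l ≤ k → ∃ (MeetsFirst l)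
  prefix zero    _   = 0 , λ _ ()
  prefix (suc l) l<k = let n , met = prefix l (<⇒≤ l<k) in extend l l<k n met

corollary4p7 : (k : ℕ) (i : Fin k → ℕ) (m : Fin k → ℕ)
    → (∀ j → Prime (i j))
    → (∀ j j′ → j <ᶠ j′ → i j < i j′)
    → (∀ j → m j < i j)
    → ∃ λ (n : ℕ) → ∀ j → bbar (i j) n ≡ m j
corollary4p7 k i m prime increasing m<i =
  sequential-adjustment k (λ j → bbar (i j)) (λ j → (i j ∸ 1) !) m
    (λ j′ j j′<j n K → bbar-stable (i j′) (i j) n K (two≤prime (prime j′)) (increasing j′ j j′<j))
    (λ j n → bbar-adjustable (i j) n (m j) (prime j) (m<i j))
  where
  two≤prime : ∀ {p} → Prime p → 2 ≤ p
  two≤prime {zero}        pr = contradiction pr ¬prime[0]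
  two≤prime {suc zero}    pr = contradiction pr ¬prime[1]
  two≤prime {suc (suc _)} _  = s≤s (s≤s z≤n)
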